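{- Let $G=(V,W,E)$ be a bipartite graph. Then $|\mathrm{Aut}(R(G))| = 2^{|W| - \mathrm{rk}(A_G)}$.
   Context: Multipede construction $R(G)$ for a bipartite graph $G=(V,W,E)$: for each $w\in W$ there are vertices $a(w),b(w)$, with $F(w)=\{a(w),b(w)\}$; for each $v\in V$ and each $A\subseteq N(v)$ with $|A|$ even a vertex $m_A(v)$, with $M(v)$ the set of these. Edges: $\{a(w),m_A(v)\}$ for $w\in A$ and $\{b(w),m_A(v)\}$ for $w\in N(v)\setminus A$. $R(G)$ is vertex-colored with color classes exactly the sets $F(w)$ ($w\in W$) and $M(v)$ ($v\in V$); $\mathrm{Aut}(R(G))$ is the group of color-preserving automorphisms. $A_G\in\mathbb{F}_2^{V\times W}$ is the matrix with $(A_G)_{v,w}=1$ iff $\{v,w\}\in E$, and $\mathrm{rk}$ is rank over $\mathbb{F}_2$. -}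

module Defs where

open import Data.Bool using (Bool; true; false; not; _∧_; _∨_; _xor_; T)
open import Data.Nat using (ℕ; zero; suc; _≤_; _≡ᵇ_)
open import Data.Nat.DivMod using (_%_)
open import Data.Fin using (Fin; zero; suc)
open import Data.Fin.Subset using (Subset; _⊆_; ∣_∣; Nonempty)
open import Data.Vec using (lookup)
open import Data.Sum using (_⊎_; inj₁; inj₂)
open import Data.Product using (Σ; ∃; _×_; _,_)
open import Relation.Binary using (Setoid)
open import Relation.Binary.PropositionalEquality using (_≡_; refl; sym; trans)

-- A finite bipartite graph G = (V, W, E) with V = Fin n, W = Fin m,
-- given by its biadjacency matrix  adj v w = true  iff {v,w} ∈ E.
-- (This is also the matrix A_G over F₂, with Bool = F₂.)
BiGraph : ℕ → ℕ → Set
BiGraph n m = Fin n → Fin m → Bool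

allFin : ∀ {k} → (Fin k → Bool) → Bool
allFin {zero} p = true
allFin {suc k} p = p zero ∧ allFin (λ i → p (suc i))

xorSum : ∀ {k} → (Fin k → Bool) → Bool
xorSum {zero} p = false
xorSum {suc k} p = p zero xor xorSum (λ i → p (suc i))

rowSum : ∀ {n m} → BiGraph n m → Subset n → Fin m → Bool
rowSum adj S w = xorSum (λ v → lookup S v ∧ adj v w)

RowsIndependent : ∀ {n m} → BiGraph n m → Subset n → Set
RowsIndependent adj S =
  ∀ (T : Subset _) → T ⊆ S → Nonempty T → (∀ w → rowSum adj T w ≡ false) → Data.Empty.⊥
  where import Data.Empty

IsRank : ∀ {n m} → BiGraph n m → ℕ → Set
IsRank adj r =
  (Σ (Subset _) λ S → RowsIndependent adj S × ∣ S ∣ ≡ r)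
  × (∀ S → RowsIndependent adj S → ∣ S ∣ ≤ r)

okM : ∀ {n m} → BiGraph n m → Fin n → Subset m → Bool
okM adj v A = allFin (λ w → not (lookup A w) ∨ adj v w) ∧ ((∣ A ∣ % 2) ≡ᵇ 0)

data Vert {n m} (adj : BiGraph n m) : Set where
  a  : Fin m → Vert adj
  b  : Fin m → Vert adj
  mv : (v : Fin n) (A : Subset m) → T (okM adj v A) → Vert adj

colour : ∀ {n m} {adj : BiGraph n m} → Vert adj → Fin m ⊎ Fin n
colour (a w) = inj₁ w
colour (b w) = inj₁ w
colour (mv v A _) = inj₂ v

edge : ∀ {n m} {adj : BiGraph n m} → Vert adj → Vert adj → Bool
edge {adj = adj} (a w) (mv v A _) = lookup A w
edge {adj = adj} (b w) (mv v A _) = adj v w ∧ not (lookup A w)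
edge {adj = adj} (mv v A _) (a w) = lookup A w
edge {adj = adj} (mv v A _) (b w) = adj v w ∧ not (lookup A w)
edge _ _ = false

record Aut {n m} (adj : BiGraph n m) : Set where
  field
    to      : Vert adj → Vert adj
    from    : Vert adj → Vert adj
    from-to : ∀ x → from (to x) ≡ x
    to-from : ∀ x → to (from x) ≡ x
    colour-pres : ∀ x → colour (to x) ≡ colour x
    edge-pres   : ∀ x y → edge (to x) (to y) ≡ edge x y

AutSetoid : ∀ {n m} → BiGraph n m → Setoid _ _
AutSetoid adj = record
  { Carrier = Aut adj
  ; _≈_ = λ f g → ∀ x → Aut.to f x ≡ Aut.to g x
  ; isEquivalence = record
    { refl = λ x → refl
    ; sym = λ p x → sym (p x)
    ; trans = λ p q x → trans (p x) (q x) } }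

module Submission where

-- The proof passes through the kernel K = ker A_G ⊆ F₂^W, in two independent parts.
--
-- (1) Aut(R(G)) ≅ K.  A kernel vector x gives the automorphism σ_x that swaps
--     a(w) and b(w) when x_w = 1 and sends m_A(v) to m_{A + x∩N(v)}(v); the new
--     label is even because x ∩ N(v) is.  Conversely every automorphism φ equals
--     σ_x for x_w = [φ(a(w)) = b(w)]: the image of a middle vertex is forced by its
--     adjacencies to the a(w), and applying this to m_∅(v) shows that x ∈ K.
-- (2) Rank–nullity over F₂: |K| = 2^(m ∸ r).  Gaussian elimination on the first
--     column, by induction on the number m of columns, produces the nullity k with
--     K ≅ Fin (2^k) together with m ∸ k independent rows, and shows that no
--     independent family of rows is larger.

open import Defs
open import Algebra.Bundles using (CommutativeRing)
open import Data.Bool using (Bool; true; false; not; _∧_; _∨_; _xor_; T)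
import Data.Bool as Bool
open import Data.Bool.Properties
  using ( xor-∧-commutativeRing; xor-comm; xor-assoc; xor-same; xor-identityʳ; xor-inverseˡ
        ; not-involutive; ∧-comm; ∧-assoc; ∧-identityʳ; ∧-zeroʳ; ∧-distribˡ-xor; ∧-distribʳ-xor
        ; ¬-not; T-≡; T-∧; T-not-≡; T-irrelevant )
open import Data.Fin using (Fin; zero; suc; _≟_)
open import Data.Fin.Permutation using (↔⇒≡)
open import Data.Fin.Properties using (any?; 2↔Bool; *↔×)
open import Data.Fin.Subset using (Subset; _∈_; _∉_; _⊆_; ∣_∣; Nonempty; ⁅_⁆; ⊥)
open import Data.Fin.Subset.Properties using (x∈⁅x⁆; x∈⁅y⁆⇒x≡y; _∈?_; ∉⊥; ∣⊥∣≡0; Empty-unique)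
open import Data.Nat using (ℕ; zero; suc; _+_; _∸_; _^_; _≤_; s≤s; _≡ᵇ_)
open import Data.Nat.DivMod using (_%_)
open import Data.Nat.Logarithm using (⌊log₂_⌋; ⌊log₂[2^n]⌋≡n)
open import Data.Nat.Properties
  using (module ≤-Reasoning; +-identityʳ; +-suc; ≤-reflexive; ≤-trans; ≤-antisym; n≤1+n; +-monoˡ-≤; m+n∸m≡n)
open import Data.Product using (Σ; _×_; _,_; proj₁; proj₂)
open import Data.Product.Function.NonDependent.Propositional using (_×-↔_)
open import Data.Sum using (inj₁; inj₂)
open import Data.Vec using (Vec; []; _∷_; lookup; tabulate; _[_]≔_; here; there)
open import Data.Vec.Properties
  using ( []=⇒lookup; lookup⇒[]=; lookup∘update; lookup∘update′; []≔-lookup; []≔-minimal; []≔-idempotent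
        ; lookup-replicate; lookup∘tabulate; tabulate∘lookup; tabulate-cong )
open import Function.Bundles using (_⇔_; mk⇔; Equivalence; _↔_; mk↔ₛ′; Inverse)
import Function.Construct.Composition as Composition
open import Function.Properties.Inverse using (↔-sym; ↔-trans)
open import Relation.Binary.PropositionalEquality
open import Relation.Binary.PropositionalEquality.Properties using (setoid)
open import Relation.Nullary using (yes; no)
open import Relation.Nullary.Decidable using (_×-dec_)

module F₂ = CommutativeRing xor-∧-commutativeRing
open import Algebra.Properties.Semiring.Sum F₂.semiring
  using (sum; sum-cong-≗; sum-replicate-zero; ∑-distrib-+; *-distribˡ-sum; *-distribʳ-sum)

xor≡false⇒≡ : ∀ {p q} → p xor q ≡ false → p ≡ q
xor≡false⇒≡ {false} {false} _ = refl
xor≡false⇒≡ {true} {true} _ = refl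

implication⇔ : ∀ x y → T (not x ∨ y) ⇔ (x ≡ true → y ≡ true)
implication⇔ false y = mk⇔ (λ _ ()) (λ _ → _)
implication⇔ true y = mk⇔ (λ t _ → Equivalence.to T-≡ t) (λ y≡1 → Equivalence.from T-≡ (y≡1 refl))

allFin⇔ : ∀ {k} (p : Fin k → Bool) → T (allFin p) ⇔ (∀ i → T (p i))
allFin⇔ {zero} p = mk⇔ (λ _ ()) (λ _ → _)
allFin⇔ {suc k} p = mk⇔ to from
  where
  to : T (allFin p) → ∀ i → T (p i)
  to t zero = proj₁ (Equivalence.to T-∧ t)
  to t (suc i) = Equivalence.to (allFin⇔ (λ i → p (suc i))) (proj₂ (Equivalence.to T-∧ t)) i
  from : (∀ i → T (p i)) → T (allFin p)
  from h = Equivalence.from T-∧ (h zero , Equivalence.from (allFin⇔ (λ i → p (suc i))) (λ i → h (suc i)))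

-- xorSum is the finite sum of the field F₂ = (Bool, xor, ∧) from the library,
-- which provides its linearity laws.
xorSum≡sum : ∀ {k} (f : Fin k → Bool) → xorSum f ≡ sum f
xorSum≡sum {zero} f = refl
xorSum≡sum {suc k} f = cong (f zero xor_) (xorSum≡sum (λ i → f (suc i)))

xorSum-cong : ∀ {k} {f g : Fin k → Bool} → (∀ i → f i ≡ g i) → xorSum f ≡ xorSum g
xorSum-cong {f = f} {g} f≗g = trans (xorSum≡sum f) (trans (sum-cong-≗ f≗g) (sym (xorSum≡sum g)))

xorSum-xor : ∀ {k} (f g : Fin k → Bool) → xorSum (λ i → f i xor g i) ≡ xorSum f xor xorSum g
xorSum-xor f g = begin
  xorSum (λ i → f i xor g i) ≡⟨ xorSum≡sum (λ i → f i xor g i) ⟩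
  sum (λ i → f i xor g i)    ≡⟨ ∑-distrib-+ f g ⟩
  sum f xor sum g            ≡⟨ sym (cong₂ _xor_ (xorSum≡sum f) (xorSum≡sum g)) ⟩
  xorSum f xor xorSum g      ∎
  where open ≡-Reasoning

xorSum-∧ˡ : ∀ {k} c (f : Fin k → Bool) → xorSum (λ i → c ∧ f i) ≡ c ∧ xorSum f
xorSum-∧ˡ c f = begin
  xorSum (λ i → c ∧ f i) ≡⟨ xorSum≡sum (λ i → c ∧ f i) ⟩
  sum (λ i → c ∧ f i)    ≡⟨ *-distribˡ-sum c f ⟨
  c ∧ sum f              ≡⟨ cong (c ∧_) (xorSum≡sum f) ⟨
  c ∧ xorSum f           ∎
  where open ≡-Reasoning

xorSum-∧ʳ : ∀ {k} c (f : Fin k → Bool) → xorSum (λ i → f i ∧ c) ≡ xorSum f ∧ c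
xorSum-∧ʳ c f = begin
  xorSum (λ i → f i ∧ c) ≡⟨ xorSum≡sum (λ i → f i ∧ c) ⟩
  sum (λ i → f i ∧ c)    ≡⟨ *-distribʳ-sum c f ⟨
  sum f ∧ c              ≡⟨ cong (_∧ c) (xorSum≡sum f) ⟨
  xorSum f ∧ c           ∎
  where open ≡-Reasoning

xorSum-zero : ∀ {k} {f : Fin k → Bool} → (∀ i → f i ≡ false) → xorSum f ≡ false
xorSum-zero {k} {f} f≡0 = trans (xorSum-cong f≡0) (trans (xorSum≡sum {k} (λ _ → false)) (sum-replicate-zero k))

xorSum-support : ∀ {k} (T : Subset k) (g : Fin k → Bool) →
  xorSum (λ i → lookup T i ∧ g i) ≡ true → Nonempty T
xorSum-support (true ∷ T) g _ = zero , here
xorSum-support (false ∷ T) g sum≡1 with xorSum-support T (λ i → g (suc i)) sum≡1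
... | i , i∈T = suc i , there i∈T

xorSum-singleton : ∀ {k} (u : Fin k) (g : Fin k → Bool) → xorSum (λ i → lookup ⁅ u ⁆ i ∧ g i) ≡ g u
xorSum-singleton {suc k} zero g =
  trans (cong (g zero xor_) (xorSum-zero (λ i → cong (_∧ g (suc i)) (lookup-replicate i false))))
        (xor-identityʳ (g zero))
xorSum-singleton (suc u) g = xorSum-singleton u (λ i → g (suc i))

xorSum-split : ∀ {k} (T : Subset k) (g : Fin k → Bool) u →
  xorSum (λ i → lookup T i ∧ g i) ≡ xorSum (λ i → lookup (T [ u ]≔ false) i ∧ g i) xor (lookup T u ∧ g u)
xorSum-split (t ∷ T) g zero = xor-comm (t ∧ g zero) _
xorSum-split (t ∷ T) g (suc u) =
  trans (cong ((t ∧ g zero) xor_) (xorSum-split T (λ i → g (suc i)) u)) (sym (xor-assoc (t ∧ g zero) _ _))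

∈⇒lookup : ∀ {k} {S : Subset k} {x} → x ∈ S → lookup S x ≡ true
∈⇒lookup = []=⇒lookup

lookup⇒∈ : ∀ {k} {S : Subset k} {x} → lookup S x ≡ true → x ∈ S
lookup⇒∈ {S = S} {x} = lookup⇒[]= x S

u∉remove : ∀ {k} (S : Subset k) u → u ∉ S [ u ]≔ false
u∉remove S u u∈ with trans (sym (∈⇒lookup u∈)) (lookup∘update u S false)
... | ()

∈-remove⇒≢ : ∀ {k} {S : Subset k} {u x} → x ∈ S [ u ]≔ false → x ≢ u
∈-remove⇒≢ {S = S} x∈ refl = u∉remove S _ x∈

∈-update⁻ : ∀ {k} {S : Subset k} {u x b} → x ≢ u → x ∈ S [ u ]≔ b → x ∈ S
∈-update⁻ {S = S} x≢u x∈ = lookup⇒∈ (trans (sym (lookup∘update′ x≢u S _)) (∈⇒lookup x∈))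

update-same : ∀ {k} (S : Subset k) {u b} → lookup S u ≡ b → S [ u ]≔ b ≡ S
update-same S {u} Su≡b = trans (cong (S [ u ]≔_) (sym Su≡b)) ([]≔-lookup S u)

∣insert∣ : ∀ {k} (S : Subset k) u → ∣ S [ u ]≔ true ∣ ≡ suc ∣ S [ u ]≔ false ∣
∣insert∣ (s ∷ S) zero = refl
∣insert∣ (true ∷ S) (suc u) = cong suc (∣insert∣ S u)
∣insert∣ (false ∷ S) (suc u) = ∣insert∣ S u

zeroRow-∉ : ∀ {n m} (adj : BiGraph n m) {S u} → RowsIndependent adj S → (∀ w → adj u w ≡ false) → u ∉ S
zeroRow-∉ adj {S} {u} indep row≡0 u∈S =
  indep ⁅ u ⁆ (λ x∈⁅u⁆ → subst (_∈ S) (sym (x∈⁅y⁆⇒x≡y u x∈⁅u⁆)) u∈S) (u , x∈⁅x⁆ u)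
        (λ w → trans (xorSum-singleton u (λ v → adj v w)) (row≡0 w))

rowSum-insert : ∀ {n m} (adj : BiGraph n m) T u c → lookup T u ≡ false →
  ∀ w → rowSum adj (T [ u ]≔ c) w ≡ rowSum adj T w xor (c ∧ adj u w)
rowSum-insert adj T u c u∉T w = begin
  rowSum adj (T [ u ]≔ c) w
    ≡⟨ xorSum-split (T [ u ]≔ c) (λ v → adj v w) u ⟩
  rowSum adj ((T [ u ]≔ c) [ u ]≔ false) w xor (lookup (T [ u ]≔ c) u ∧ adj u w)
    ≡⟨ cong₂ (λ S b → rowSum adj S w xor (b ∧ adj u w))
             (trans ([]≔-idempotent T u) (update-same T u∉T)) (lookup∘update u T c) ⟩
  rowSum adj T w xor (c ∧ adj u w) ∎
  where open ≡-Reasoning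

rowSum-removeZeroRow : ∀ {n m} (adj : BiGraph n m) {u} → (∀ w → adj u w ≡ false) →
  ∀ T w → rowSum adj (T [ u ]≔ false) w ≡ rowSum adj T w
rowSum-removeZeroRow adj {u} row≡0 T w = sym (begin
  rowSum adj T w
    ≡⟨ xorSum-split T (λ v → adj v w) u ⟩
  rowSum adj (T [ u ]≔ false) w xor (lookup T u ∧ adj u w)
    ≡⟨ cong (λ b → rowSum adj (T [ u ]≔ false) w xor (lookup T u ∧ b)) (row≡0 w) ⟩
  rowSum adj (T [ u ]≔ false) w xor (lookup T u ∧ false)
    ≡⟨ cong (rowSum adj (T [ u ]≔ false) w xor_) (∧-zeroʳ (lookup T u)) ⟩
  rowSum adj (T [ u ]≔ false) w xor false
    ≡⟨ xor-identityʳ _ ⟩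
  rowSum adj (T [ u ]≔ false) w ∎)
  where open ≡-Reasoning

rowSum-vanishing : ∀ {n m} (adj : BiGraph n m) T w → (∀ v → v ∈ T → adj v w ≡ false) → rowSum adj T w ≡ false
rowSum-vanishing adj T w vanish = xorSum-zero term
  where
  term : ∀ v → lookup T v ∧ adj v w ≡ false
  term v with lookup T v in Tv
  ... | false = refl
  ... | true = vanish v (lookup⇒∈ Tv)

-- The kernel of A_G over F₂.  Membership is a Boolean condition, so its proofs are
-- irrelevant and Ker adj is a set of vectors with propositional equality.
dot : ∀ {n m} → BiGraph n m → Fin n → Vec Bool m → Bool
dot adj v x = xorSum (λ w → adj v w ∧ lookup x w)

inKer : ∀ {n m} → BiGraph n m → Vec Bool m → Bool
inKer adj x = allFin (λ v → not (dot adj v x))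

record Ker {n m} (adj : BiGraph n m) : Set where
  constructor mkKer
  field
    vec    : Vec Bool m
    solves : T (inKer adj vec)

inKer-elim : ∀ {n m} (adj : BiGraph n m) x → T (inKer adj x) → ∀ v → dot adj v x ≡ false
inKer-elim adj x t v = Equivalence.to T-not-≡ (Equivalence.to (allFin⇔ _) t v)

inKer-intro : ∀ {n m} (adj : BiGraph n m) x → (∀ v → dot adj v x ≡ false) → T (inKer adj x)
inKer-intro adj x h = Equivalence.from (allFin⇔ _) (λ v → Equivalence.from T-not-≡ (h v))

Ker-≡ : ∀ {n m} {adj : BiGraph n m} {x y} {p : T (inKer adj x)} {q : T (inKer adj y)} →
  x ≡ y → _≡_ {A = Ker adj} (mkKer x p) (mkKer y q)
Ker-≡ {p = p} {q} refl = cong (mkKer _) (T-irrelevant p q)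

dropCol : ∀ {n m} → BiGraph n (suc m) → BiGraph n m
dropCol adj v w = adj v (suc w)

-- Eliminating with pivot row u: row u is added to every row with a 1 in
-- column 0, after which column 0 is deleted.
eliminate : ∀ {n m} → BiGraph n (suc m) → Fin n → BiGraph n m
eliminate adj u v w = adj v (suc w) xor (adj v zero ∧ adj u (suc w))

eliminate-pivot : ∀ {n m} (adj : BiGraph n (suc m)) {u} → adj u zero ≡ true → ∀ w → eliminate adj u u w ≡ false
eliminate-pivot adj {u} pivot w rewrite pivot = xor-same (adj u (suc w))

rowSum-eliminate : ∀ {n m} (adj : BiGraph n (suc m)) u T w →
  rowSum (eliminate adj u) T w ≡ rowSum adj T (suc w) xor (rowSum adj T zero ∧ adj u (suc w))
rowSum-eliminate adj u T w = begin
  rowSum (eliminate adj u) T w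
    ≡⟨ xorSum-cong (λ v → distribute (lookup T v) (adj v (suc w)) (adj v zero) (adj u (suc w))) ⟩
  xorSum (λ v → (lookup T v ∧ adj v (suc w)) xor ((lookup T v ∧ adj v zero) ∧ adj u (suc w)))
    ≡⟨ xorSum-xor (λ v → lookup T v ∧ adj v (suc w)) (λ v → (lookup T v ∧ adj v zero) ∧ adj u (suc w)) ⟩
  rowSum adj T (suc w) xor xorSum (λ v → (lookup T v ∧ adj v zero) ∧ adj u (suc w))
    ≡⟨ cong (rowSum adj T (suc w) xor_) (xorSum-∧ʳ (adj u (suc w)) (λ v → lookup T v ∧ adj v zero)) ⟩
  rowSum adj T (suc w) xor (rowSum adj T zero ∧ adj u (suc w)) ∎
  where
  open ≡-Reasoning
  distribute : ∀ t p c q → t ∧ (p xor (c ∧ q)) ≡ (t ∧ p) xor ((t ∧ c) ∧ q)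
  distribute t p c q = trans (∧-distribˡ-xor t p (c ∧ q)) (cong ((t ∧ p) xor_) (sym (∧-assoc t c q)))

-- Products with a vector after elimination: x solves row v of the eliminated
-- system iff x, extended by the value forced by the pivot row, solves row v of A.
dot-eliminate : ∀ {n m} (adj : BiGraph n (suc m)) u v x →
  dot (eliminate adj u) v x ≡ dot adj v (dot (dropCol adj) u x ∷ x)
dot-eliminate adj u v x = begin
  dot (eliminate adj u) v x
    ≡⟨ xorSum-cong (λ w → distribute (adj v (suc w)) (adj v zero) (adj u (suc w)) (lookup x w)) ⟩
  xorSum (λ w → (adj v (suc w) ∧ lookup x w) xor (adj v zero ∧ (adj u (suc w) ∧ lookup x w)))
    ≡⟨ xorSum-xor (λ w → adj v (suc w) ∧ lookup x w) (λ w → adj v zero ∧ (adj u (suc w) ∧ lookup x w)) ⟩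
  dot (dropCol adj) v x xor xorSum (λ w → adj v zero ∧ (adj u (suc w) ∧ lookup x w))
    ≡⟨ cong (dot (dropCol adj) v x xor_) (xorSum-∧ˡ (adj v zero) (λ w → adj u (suc w) ∧ lookup x w)) ⟩
  dot (dropCol adj) v x xor (adj v zero ∧ dot (dropCol adj) u x)
    ≡⟨ xor-comm (dot (dropCol adj) v x) _ ⟩
  dot adj v (dot (dropCol adj) u x ∷ x) ∎
  where
  open ≡-Reasoning
  distribute : ∀ p c q y → (p xor (c ∧ q)) ∧ y ≡ (p ∧ y) xor (c ∧ (q ∧ y))
  distribute p c q y = trans (∧-distribʳ-xor y p (c ∧ q)) (cong ((p ∧ y) xor_) (∧-assoc c q y))

ker-zeroCol : ∀ {n m} (adj : BiGraph n (suc m)) → (∀ v → adj v zero ≡ false) →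
  Ker adj ↔ (Bool × Ker (dropCol adj))
ker-zeroCol adj col≡0 = mk↔ₛ′ to from
  (λ { (x₀ , mkKer x p) → cong (x₀ ,_) (Ker-≡ refl) }) (λ { (mkKer (x₀ ∷ x) p) → Ker-≡ refl })
  where
  dot-drop : ∀ v x₀ x → dot adj v (x₀ ∷ x) ≡ dot (dropCol adj) v x
  dot-drop v x₀ x = cong (λ c → (c ∧ x₀) xor dot (dropCol adj) v x) (col≡0 v)
  to : Ker adj → Bool × Ker (dropCol adj)
  to (mkKer (x₀ ∷ x) p) = x₀ , mkKer x
    (inKer-intro (dropCol adj) x (λ v → trans (sym (dot-drop v x₀ x)) (inKer-elim adj (x₀ ∷ x) p v)))
  from : Bool × Ker (dropCol adj) → Ker adj
  from (x₀ , mkKer x p) = mkKer (x₀ ∷ x)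
    (inKer-intro adj (x₀ ∷ x) (λ v → trans (dot-drop v x₀ x) (inKer-elim (dropCol adj) x p v)))

-- With a pivot u in column 0, the pivot row forces the first coordinate of a
-- kernel vector, and the rest is a kernel vector of the eliminated matrix.
ker-eliminate : ∀ {n m} (adj : BiGraph n (suc m)) {u} → adj u zero ≡ true →
  Ker adj ↔ Ker (eliminate adj u)
ker-eliminate adj {u} pivot = mk↔ₛ′ to from (λ _ → Ker-≡ refl)
  (λ { (mkKer (x₀ ∷ x) p) → Ker-≡ (cong (_∷ x) (sym (forced x₀ x p))) })
  where
  forced : ∀ x₀ x → T (inKer adj (x₀ ∷ x)) → x₀ ≡ dot (dropCol adj) u x
  forced x₀ x p =
    xor≡false⇒≡ (subst (λ c → (c ∧ x₀) xor dot (dropCol adj) u x ≡ false) pivot (inKer-elim adj (x₀ ∷ x) p u))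
  to : Ker adj → Ker (eliminate adj u)
  to (mkKer (x₀ ∷ x) p) = mkKer x (inKer-intro (eliminate adj u) x (λ v → trans (dot-eliminate adj u v x)
    (subst (λ y → dot adj v (y ∷ x) ≡ false) (forced x₀ x p) (inKer-elim adj (x₀ ∷ x) p v))))
  from : Ker (eliminate adj u) → Ker adj
  from (mkKer x p) = mkKer (dot (dropCol adj) u x ∷ x)
    (inKer-intro adj (dot (dropCol adj) u x ∷ x)
      (λ v → trans (sym (dot-eliminate adj u v x)) (inKer-elim (eliminate adj u) x p v)))

indep-dropCol⁺ : ∀ {n m} (adj : BiGraph n (suc m)) {S} → RowsIndependent (dropCol adj) S → RowsIndependent adj S
indep-dropCol⁺ adj indep T T⊆S ne sum≡0 = indep T T⊆S ne (λ w → sum≡0 (suc w))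

indep-dropCol⁻ : ∀ {n m} (adj : BiGraph n (suc m)) {S} → (∀ v → v ∈ S → adj v zero ≡ false) →
  RowsIndependent adj S → RowsIndependent (dropCol adj) S
indep-dropCol⁻ adj clean indep T T⊆S ne sum≡0 = indep T T⊆S ne sums
  where
  sums : ∀ w → rowSum adj T w ≡ false
  sums zero = rowSum-vanishing adj T zero (λ v v∈T → clean v (T⊆S v∈T))
  sums (suc w) = sum≡0 w

-- Rows with a 0 in the pivot column are untouched by elimination, so an
-- independent family of such rows stays independent.
indep-eliminate-clean : ∀ {n m} (adj : BiGraph n (suc m)) {S} u → (∀ v → v ∈ S → adj v zero ≡ false) →
  RowsIndependent adj S → RowsIndependent (eliminate adj u) S
indep-eliminate-clean adj u clean indep T T⊆S ne sum≡0 = indep T T⊆S ne sums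
  where
  column₀ : rowSum adj T zero ≡ false
  column₀ = rowSum-vanishing adj T zero (λ v v∈T → clean v (T⊆S v∈T))
  sums : ∀ w → rowSum adj T w ≡ false
  sums zero = column₀
  sums (suc w) = begin
    rowSum adj T (suc w)                                        ≡⟨ xor-identityʳ _ ⟨
    rowSum adj T (suc w) xor false                              ≡⟨ cong (λ c → rowSum adj T (suc w) xor (c ∧ adj u (suc w))) column₀ ⟨
    rowSum adj T (suc w) xor (rowSum adj T zero ∧ adj u (suc w)) ≡⟨ rowSum-eliminate adj u T w ⟨
    rowSum (eliminate adj u) T w                                ≡⟨ sum≡0 w ⟩
    false                                                       ∎
    where open ≡-Reasoning

indep-extend : ∀ {n m} (adj : BiGraph n (suc m)) {u S} → adj u zero ≡ true →
  RowsIndependent (eliminate adj u) S → RowsIndependent adj (S [ u ]≔ true)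
indep-extend adj {u} {S} pivot indep T T⊆S⁺ ne sum≡0 = indep T⁻ T⁻⊆S (nonempty (lookup T u) refl) sum⁻≡0
  where
  T⁻ = T [ u ]≔ false
  T⁻⊆S : T⁻ ⊆ S
  T⁻⊆S y∈T⁻ = ∈-update⁻ (∈-remove⇒≢ y∈T⁻) (T⊆S⁺ (∈-update⁻ (∈-remove⇒≢ y∈T⁻) y∈T⁻))
  sum⁻≡0 : ∀ w → rowSum (eliminate adj u) T⁻ w ≡ false
  sum⁻≡0 w = begin
    rowSum (eliminate adj u) T⁻ w
      ≡⟨ rowSum-removeZeroRow (eliminate adj u) (eliminate-pivot adj pivot) T w ⟩
    rowSum (eliminate adj u) T w
      ≡⟨ rowSum-eliminate adj u T w ⟩
    rowSum adj T (suc w) xor (rowSum adj T zero ∧ adj u (suc w))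
      ≡⟨ cong₂ (λ p c → p xor (c ∧ adj u (suc w))) (sum≡0 (suc w)) (sum≡0 zero) ⟩
    false ∎
    where open ≡-Reasoning
  -- T⁻ is nonempty: either u ∉ T and T⁻ = T, or the pivot entry forces a
  -- nonzero column-0 sum over T⁻.
  nonempty : ∀ t → lookup T u ≡ t → Nonempty T⁻
  nonempty false u∉T = subst Nonempty (sym (update-same T u∉T)) ne
  nonempty true u∈T = xorSum-support T⁻ (λ v → adj v zero) (xor≡false⇒≡ (begin
    rowSum adj T⁻ zero xor true                      ≡⟨ cong₂ (λ t p → rowSum adj T⁻ zero xor (t ∧ p)) u∈T pivot ⟨
    rowSum adj T⁻ zero xor (lookup T u ∧ adj u zero) ≡⟨ xorSum-split T (λ v → adj v zero) u ⟨
    rowSum adj T zero                                ≡⟨ sum≡0 zero ⟩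
    false                                            ∎))
    where open ≡-Reasoning

-- Removing the pivot row u from an independent family containing it gives a
-- family that is independent after elimination: a dependency T among the
-- eliminated rows yields the dependency T, with row u added iff the column-0
-- sum of T is 1, among the original rows.
indep-restrict : ∀ {n m} (adj : BiGraph n (suc m)) {u S} → adj u zero ≡ true → u ∈ S →
  RowsIndependent adj S → RowsIndependent (eliminate adj u) (S [ u ]≔ false)
indep-restrict adj {u} {S} pivot u∈S indep T T⊆S⁻ (x , x∈T) sum≡0 = indep T⁺ T⁺⊆S (x , x∈T⁺) sum⁺≡0
  where
  c = rowSum adj T zero
  T⁺ = T [ u ]≔ c
  u∉T : lookup T u ≡ false
  u∉T = ¬-not (λ u∈T → u∉remove S u (T⊆S⁻ (lookup⇒∈ u∈T)))
  x∈T⁺ : x ∈ T⁺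
  x∈T⁺ = []≔-minimal T x u (∈-remove⇒≢ (T⊆S⁻ x∈T)) x∈T
  T⁺⊆S : T⁺ ⊆ S
  T⁺⊆S {y} y∈T⁺ with y ≟ u
  ... | yes refl = u∈S
  ... | no y≢u = ∈-update⁻ y≢u (T⊆S⁻ (∈-update⁻ y≢u y∈T⁺))
  sum⁺≡0 : ∀ w → rowSum adj T⁺ w ≡ false
  sum⁺≡0 zero = begin
    rowSum adj T⁺ zero         ≡⟨ rowSum-insert adj T u c u∉T zero ⟩
    c xor (c ∧ adj u zero)     ≡⟨ cong (λ p → c xor (c ∧ p)) pivot ⟩
    c xor (c ∧ true)           ≡⟨ cong (c xor_) (∧-identityʳ c) ⟩
    c xor c                    ≡⟨ xor-same c ⟩
    false                      ∎
    where open ≡-Reasoning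
  sum⁺≡0 (suc w) = begin
    rowSum adj T⁺ (suc w)                   ≡⟨ rowSum-insert adj T u c u∉T (suc w) ⟩
    rowSum adj T (suc w) xor (c ∧ adj u (suc w)) ≡⟨ rowSum-eliminate adj u T w ⟨
    rowSum (eliminate adj u) T w            ≡⟨ sum≡0 w ⟩
    false                                   ∎
    where open ≡-Reasoning

exponent-unique : ∀ {A : Set} {k l} → A ↔ Fin (2 ^ k) → A ↔ Fin (2 ^ l) → k ≡ l
exponent-unique {k = k} {l} A↔2^k A↔2^l = begin
  k             ≡⟨ ⌊log₂[2^n]⌋≡n k ⟨
  ⌊log₂ 2 ^ k ⌋ ≡⟨ cong ⌊log₂_⌋ (↔⇒≡ (↔-trans (↔-sym A↔2^k) A↔2^l)) ⟩
  ⌊log₂ 2 ^ l ⌋ ≡⟨ ⌊log₂[2^n]⌋≡n l ⟩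
  l             ∎
  where open ≡-Reasoning

record RankNullity {n m} (adj : BiGraph n m) : Set where
  field
    nullity     : ℕ
    kernel      : Ker adj ↔ Fin (2 ^ nullity)
    basis       : Subset n
    independent : RowsIndependent adj basis
    basis-size  : ∣ basis ∣ + nullity ≡ m
    maximal     : ∀ S → RowsIndependent adj S → ∣ S ∣ + nullity ≤ m

-- Without columns, the kernel is {0} and every row is zero, so only ∅ is independent.
rankNullity-noColumns : ∀ {n} (adj : BiGraph n 0) → RankNullity adj
rankNullity-noColumns {n} adj = record
  { nullity     = 0
  ; kernel      = mk↔ₛ′ (λ _ → zero) (λ _ → mkKer [] (inKer-intro adj [] (λ _ → refl)))
                        (λ { zero → refl }) (λ { (mkKer [] _) → Ker-≡ refl })
  ; basis       = ⊥
  ; independent = λ T T⊆⊥ (x , x∈T) _ → ∉⊥ (T⊆⊥ x∈T)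
  ; basis-size  = trans (+-identityʳ _) (∣⊥∣≡0 n)
  ; maximal     = λ S indep → ≤-reflexive (trans (+-identityʳ _) (trans (cong ∣_∣ (Empty-unique
                    (λ (v , v∈S) → zeroRow-∉ adj indep (λ ()) v∈S))) (∣⊥∣≡0 n)))
  }

-- A zero first column adds one free coordinate to the kernel and does not
-- affect independence.
rankNullity-zeroCol : ∀ {n m} (adj : BiGraph n (suc m)) → (∀ v → adj v zero ≡ false) →
  RankNullity (dropCol adj) → RankNullity adj
rankNullity-zeroCol {m = m} adj col≡0 R = record
  { nullity     = suc nullity
  ; kernel      = ↔-trans (ker-zeroCol adj col≡0) (↔-trans (↔-sym 2↔Bool ×-↔ kernel) (↔-sym *↔×))
  ; basis       = basis
  ; independent = indep-dropCol⁺ adj independent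
  ; basis-size  = trans (+-suc ∣ basis ∣ nullity) (cong suc basis-size)
  ; maximal     = λ S indep → subst (_≤ suc m) (sym (+-suc ∣ S ∣ nullity))
                    (s≤s (maximal S (indep-dropCol⁻ adj (λ v _ → col≡0 v) indep)))
  }
  where open RankNullity R

-- A pivot v₀ in the first column: the kernel is that of the matrix eliminated
-- at v₀, whose basis extends by the pivot row.  Maximality is checked by
-- eliminating at a pivot row of the given family, if it has one.
rankNullity-pivot : ∀ {n m} (adj : BiGraph n (suc m)) {v₀} → adj v₀ zero ≡ true →
  (∀ u → RankNullity (eliminate adj u)) → RankNullity adj
rankNullity-pivot {m = m} adj {v₀} pivot R = record
  { nullity     = nullity
  ; kernel      = ↔-trans (ker-eliminate adj pivot) kernel
  ; basis       = basis [ v₀ ]≔ true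
  ; independent = indep-extend adj pivot independent
  ; basis-size  = trans (cong (_+ nullity) (trans (∣insert∣ basis v₀) (cong (λ S → suc ∣ S ∣) (update-same basis v₀∉basis))))
                        (cong suc basis-size)
  ; maximal     = maximal′
  }
  where
  open RankNullity (R v₀)
  v₀∉basis : lookup basis v₀ ≡ false
  v₀∉basis = ¬-not (λ v₀∈ → zeroRow-∉ (eliminate adj v₀) independent (eliminate-pivot adj pivot) (lookup⇒∈ v₀∈))
  maximal′ : ∀ S → RowsIndependent adj S → ∣ S ∣ + nullity ≤ suc m
  maximal′ S indep with any? (λ v → v ∈? S ×-dec adj v zero Bool.≟ true)
  ... | no noPivot = ≤-trans (maximal S (indep-eliminate-clean adj v₀ clean indep)) (n≤1+n m)
    where
    clean : ∀ v → v ∈ S → adj v zero ≡ false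
    clean v v∈S = ¬-not (λ pivotᵥ → noPivot (v , v∈S , pivotᵥ))
  ... | yes (u , u∈S , pivotᵤ) = begin
    ∣ S ∣ + nullity                  ≡⟨ cong₂ _+_ ∣S∣≡ nullity≡ ⟩
    suc (∣ S [ u ]≔ false ∣ + nullityᵤ) ≤⟨ s≤s (maximalᵤ (S [ u ]≔ false) (indep-restrict adj pivotᵤ u∈S indep)) ⟩
    suc m                            ∎
    where
    open RankNullity (R u) using () renaming (nullity to nullityᵤ; kernel to kernelᵤ; maximal to maximalᵤ)
    open ≤-Reasoning
    ∣S∣≡ : ∣ S ∣ ≡ suc ∣ S [ u ]≔ false ∣
    ∣S∣≡ = trans (cong ∣_∣ (sym (update-same S (∈⇒lookup u∈S)))) (∣insert∣ S u)
    nullity≡ : nullity ≡ nullityᵤ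
    nullity≡ = exponent-unique (↔-trans (ker-eliminate adj pivot) kernel) (↔-trans (ker-eliminate adj pivotᵤ) kernelᵤ)

rankNullity : ∀ {n} m (adj : BiGraph n m) → RankNullity adj
rankNullity zero adj = rankNullity-noColumns adj
rankNullity (suc m) adj with any? (λ v → adj v zero Bool.≟ true)
... | yes (v₀ , pivot) = rankNullity-pivot adj pivot (λ u → rankNullity m (eliminate adj u))
... | no noPivot = rankNullity-zeroCol adj (λ v → ¬-not (λ pivotᵥ → noPivot (v , pivotᵥ))) (rankNullity m (dropCol adj))

kernel-size : ∀ {n m} (adj : BiGraph n m) r → IsRank adj r → Ker adj ↔ Fin (2 ^ (m ∸ r))
kernel-size {m = m} adj r ((S , indepS , ∣S∣≡r) , rank-max) = subst (λ k → Ker adj ↔ Fin (2 ^ k)) nullity≡ kernel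
  where
  open RankNullity (rankNullity m adj)
  r+nullity≡m : r + nullity ≡ m
  r+nullity≡m = ≤-antisym (subst (λ s → s + nullity ≤ m) ∣S∣≡r (maximal S indepS))
                          (subst (_≤ r + nullity) basis-size (+-monoˡ-≤ nullity (rank-max basis independent)))
  nullity≡ : nullity ≡ m ∸ r
  nullity≡ = trans (sym (m+n∸m≡n r nullity)) (cong (_∸ r) r+nullity≡m)

isEven : ℕ → Bool
isEven k = k % 2 ≡ᵇ 0

isEven-suc : ∀ k → isEven (suc k) ≡ not (isEven k)
isEven-suc zero = refl
isEven-suc (suc zero) = refl
isEven-suc (suc (suc k)) = isEven-suc k

isEven-size : ∀ {k} (A : Subset k) → isEven ∣ A ∣ ≡ not (xorSum (lookup A))
isEven-size [] = refl
isEven-size (true ∷ A) = trans (isEven-suc ∣ A ∣) (cong not (isEven-size A))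
isEven-size (false ∷ A) = isEven-size A

InNbhd : ∀ {n m} → BiGraph n m → Fin n → Vec Bool m → Set
InNbhd adj v A = ∀ w → lookup A w ≡ true → adj v w ≡ true

okM⇔ : ∀ {n m} (adj : BiGraph n m) v A → T (okM adj v A) ⇔ (InNbhd adj v A × xorSum (lookup A) ≡ false)
okM⇔ adj v A = mk⇔
  (λ t → let (t⊆ , tEven) = Equivalence.to T-∧ t in
    (λ w → Equivalence.to (implication⇔ _ _) (Equivalence.to (allFin⇔ _) t⊆ w)) , Equivalence.to evenness tEven)
  (λ (A⊆ , A-even) → Equivalence.from T-∧
    (Equivalence.from (allFin⇔ _) (λ w → Equivalence.from (implication⇔ _ _) (A⊆ w)) , Equivalence.from evenness A-even))
  where
  evenness : T (isEven ∣ A ∣) ⇔ xorSum (lookup A) ≡ false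
  evenness = subst (λ e → T e ⇔ xorSum (lookup A) ≡ false) (sym (isEven-size A)) T-not-≡

mv-≡ : ∀ {n m} {adj : BiGraph n m} v {A B} {p q} → A ≡ B → mv {adj = adj} v A p ≡ mv v B q
mv-≡ v {p = p} {q} refl = cong (mv v _) (T-irrelevant p q)

fiber : ∀ {n m} {adj : BiGraph n m} → Fin m → Bool → Vert adj
fiber w false = a w
fiber w true = b w

isB : ∀ {n m} {adj : BiGraph n m} → Vert adj → Bool
isB (b _) = true
isB _ = false

isB-fiber : ∀ {n m} {adj : BiGraph n m} w s → isB (fiber {adj = adj} w s) ≡ s
isB-fiber w false = refl
isB-fiber w true = refl

colour-fiber : ∀ {n m} {adj : BiGraph n m} w s → colour (fiber {adj = adj} w s) ≡ inj₁ w
colour-fiber w false = refl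
colour-fiber w true = refl

fiber-view : ∀ {n m} {adj : BiGraph n m} {w} (y : Vert adj) → colour y ≡ inj₁ w → y ≡ fiber w (isB y)
fiber-view (a w) refl = refl
fiber-view (b w) refl = refl

middle-view : ∀ {n m} {adj : BiGraph n m} {v} (y : Vert adj) → colour y ≡ inj₂ v →
  Σ (Vec Bool m) λ B → Σ (T (okM adj v B)) λ q → y ≡ mv v B q
middle-view (mv v B q) refl = B , q , refl

edge-sym : ∀ {n m} {adj : BiGraph n m} (x y : Vert adj) → edge x y ≡ edge y x
edge-sym (a _) (a _) = refl
edge-sym (a _) (b _) = refl
edge-sym (a _) (mv _ _ _) = refl
edge-sym (b _) (a _) = refl
edge-sym (b _) (b _) = refl
edge-sym (b _) (mv _ _ _) = refl
edge-sym (mv _ _ _) (a _) = refl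
edge-sym (mv _ _ _) (b _) = refl
edge-sym (mv _ _ _) (mv _ _ _) = refl

fibers-nonadjacent : ∀ {n m} {adj : BiGraph n m} w s w′ t → edge (fiber {adj = adj} w s) (fiber w′ t) ≡ false
fibers-nonadjacent w false w′ false = refl
fibers-nonadjacent w false w′ true = refl
fibers-nonadjacent w true w′ false = refl
fibers-nonadjacent w true w′ true = refl

edge-fiber : ∀ {n m} (adj : BiGraph n m) w s v A p → edge (fiber w s) (mv {adj = adj} v A p) ≡ adj v w ∧ (s xor lookup A w)
edge-fiber adj w false v A p = absorb (lookup A w) (adj v w) (proj₁ (Equivalence.to (okM⇔ adj v A) p) w)
  where
  absorb : ∀ x j → (x ≡ true → j ≡ true) → x ≡ j ∧ x
  absorb false j _ = sym (∧-zeroʳ j)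
  absorb true j x⇒j rewrite x⇒j refl = refl
edge-fiber adj w true v A p = refl

-- Flipping the fibre index and shifting the label by the same amount cancel.
flip-invariance : ∀ j s t c → j ∧ ((s xor t) xor (c xor (t ∧ j))) ≡ j ∧ (s xor c)
flip-invariance false s t c = refl
flip-invariance true false false false = refl
flip-invariance true false false true = refl
flip-invariance true false true false = refl
flip-invariance true false true true = refl
flip-invariance true true false false = refl
flip-invariance true true false true = refl
flip-invariance true true true false = refl
flip-invariance true true true true = refl

-- The label of a middle vertex is determined by its adjacencies to the a(w):
-- if m_B(v) sees the s-th vertex of F(w) exactly when m_A(v) sees a(w),
-- then B_w = A_w + s·[w ∈ N(v)].
label-determined : ∀ j s c d → (c ≡ true → j ≡ true) → (d ≡ true → j ≡ true) →
  j ∧ (s xor d) ≡ j ∧ c → d ≡ c xor (s ∧ j)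
label-determined false s false false _ _ _ = sym (∧-zeroʳ s)
label-determined false s true d c⇒j _ _ with c⇒j refl
... | ()
label-determined false s false true _ d⇒j _ with d⇒j refl
... | ()
label-determined true false c d _ _ e = trans e (sym (xor-identityʳ c))
label-determined true true c d _ _ e = trans (sym (not-involutive d)) (trans (cong not e) (sym (xor-comm c true)))

module _ {n m} (adj : BiGraph n m) where

  shift : Fin n → Vec Bool m → Vec Bool m → Vec Bool m
  shift v x A = tabulate (λ w → lookup A w xor (lookup x w ∧ adj v w))

  lookup-shift : ∀ v x A w → lookup (shift v x A) w ≡ lookup A w xor (lookup x w ∧ adj v w)
  lookup-shift v x A = lookup∘tabulate (λ w → lookup A w xor (lookup x w ∧ adj v w))

  -- The shifted label is again valid because x ∩ N(v) is even when x ∈ ker A_G.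
  shift-valid : ∀ v x A → T (inKer adj x) → T (okM adj v A) → T (okM adj v (shift v x A))
  shift-valid v x A x∈ker p = Equivalence.from (okM⇔ adj v (shift v x A)) (shifted⊆N , shifted-even)
    where
    A⊆N = proj₁ (Equivalence.to (okM⇔ adj v A) p)
    A-even = proj₂ (Equivalence.to (okM⇔ adj v A) p)
    stays⊆ : ∀ c s j → (c ≡ true → j ≡ true) → c xor (s ∧ j) ≡ true → j ≡ true
    stays⊆ c s true _ _ = refl
    stays⊆ true s false c⇒j _ = c⇒j refl
    stays⊆ false s false _ e with trans (sym (∧-zeroʳ s)) e
    ... | ()
    shifted⊆N : InNbhd adj v (shift v x A)
    shifted⊆N w e = stays⊆ (lookup A w) (lookup x w) (adj v w) (A⊆N w) (trans (sym (lookup-shift v x A w)) e)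
    shifted-even : xorSum (lookup (shift v x A)) ≡ false
    shifted-even = begin
      xorSum (lookup (shift v x A))
        ≡⟨ xorSum-cong (lookup-shift v x A) ⟩
      xorSum (λ w → lookup A w xor (lookup x w ∧ adj v w))
        ≡⟨ xorSum-xor (lookup A) (λ w → lookup x w ∧ adj v w) ⟩
      xorSum (lookup A) xor xorSum (λ w → lookup x w ∧ adj v w)
        ≡⟨ cong₂ _xor_ A-even (xorSum-cong (λ w → ∧-comm (lookup x w) (adj v w))) ⟩
      false xor dot adj v x
        ≡⟨ inKer-elim adj x x∈ker v ⟩
      false ∎
      where open ≡-Reasoning

  shift-shift : ∀ v x A → shift v x (shift v x A) ≡ A
  shift-shift v x A = trans (tabulate-cong cancel) (tabulate∘lookup A)
    where
    cancel : ∀ w → lookup (shift v x A) w xor (lookup x w ∧ adj v w) ≡ lookup A w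
    cancel w = begin
      lookup (shift v x A) w xor (lookup x w ∧ adj v w)
        ≡⟨ cong (_xor (lookup x w ∧ adj v w)) (lookup-shift v x A w) ⟩
      (lookup A w xor (lookup x w ∧ adj v w)) xor (lookup x w ∧ adj v w)
        ≡⟨ xor-assoc (lookup A w) _ _ ⟩
      lookup A w xor ((lookup x w ∧ adj v w) xor (lookup x w ∧ adj v w))
        ≡⟨ cong (lookup A w xor_) (xor-same (lookup x w ∧ adj v w)) ⟩
      lookup A w xor false
        ≡⟨ xor-identityʳ _ ⟩
      lookup A w ∎
      where open ≡-Reasoning

  σ : Ker adj → Vert adj → Vert adj
  σ (mkKer x _) (a w) = fiber w (lookup x w)
  σ (mkKer x _) (b w) = fiber w (not (lookup x w))
  σ (mkKer x x∈ker) (mv v A p) = mv v (shift v x A) (shift-valid v x A x∈ker p)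

  σ-fiber : ∀ X w s → σ X (fiber w s) ≡ fiber w (s xor lookup (Ker.vec X) w)
  σ-fiber X w false = refl
  σ-fiber X w true = refl

  σ-involutive : ∀ X y → σ X (σ X y) ≡ y
  σ-involutive X@(mkKer x _) (a w) = trans (σ-fiber X w (lookup x w)) (cong (fiber w) (xor-same (lookup x w)))
  σ-involutive X@(mkKer x _) (b w) = trans (σ-fiber X w (not (lookup x w))) (cong (fiber w) (xor-inverseˡ (lookup x w)))
  σ-involutive (mkKer x _) (mv v A p) = mv-≡ v (shift-shift v x A)

  σ-colour : ∀ X y → colour (σ X y) ≡ colour y
  σ-colour (mkKer x _) (a w) = colour-fiber w (lookup x w)
  σ-colour (mkKer x _) (b w) = colour-fiber w (not (lookup x w))
  σ-colour (mkKer x _) (mv v A p) = refl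

  -- σ_x preserves the edges at fibre vertices; by symmetry of edge, all edges.
  σ-edge-fiber : ∀ X w s z → edge (σ X (fiber w s)) (σ X z) ≡ edge (fiber w s) z
  σ-edge-fiber X@(mkKer x _) w s (a w′) rewrite σ-fiber X w s =
    trans (fibers-nonadjacent w (s xor lookup x w) w′ (lookup x w′)) (sym (fibers-nonadjacent w s w′ false))
  σ-edge-fiber X@(mkKer x _) w s (b w′) rewrite σ-fiber X w s =
    trans (fibers-nonadjacent w (s xor lookup x w) w′ (not (lookup x w′))) (sym (fibers-nonadjacent w s w′ true))
  σ-edge-fiber X@(mkKer x x∈ker) w s (mv v A p) = begin
    edge (σ X (fiber w s)) (mv v (shift v x A) _)
      ≡⟨ cong (λ y → edge y (mv v (shift v x A) (shift-valid v x A x∈ker p))) (σ-fiber X w s) ⟩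
    edge (fiber w (s xor lookup x w)) (mv v (shift v x A) _)
      ≡⟨ edge-fiber adj w (s xor lookup x w) v (shift v x A) (shift-valid v x A x∈ker p) ⟩
    adj v w ∧ ((s xor lookup x w) xor lookup (shift v x A) w)
      ≡⟨ cong (λ c → adj v w ∧ ((s xor lookup x w) xor c)) (lookup-shift v x A w) ⟩
    adj v w ∧ ((s xor lookup x w) xor (lookup A w xor (lookup x w ∧ adj v w)))
      ≡⟨ flip-invariance (adj v w) s (lookup x w) (lookup A w) ⟩
    adj v w ∧ (s xor lookup A w)
      ≡⟨ edge-fiber adj w s v A p ⟨
    edge (fiber w s) (mv v A p) ∎
    where open ≡-Reasoning

  σ-edge : ∀ X y z → edge (σ X y) (σ X z) ≡ edge y z
  σ-edge X (a w) z = σ-edge-fiber X w false z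
  σ-edge X (b w) z = σ-edge-fiber X w true z
  σ-edge X y@(mv _ _ _) (a w) =
    trans (edge-sym (σ X y) (σ X (a w))) (trans (σ-edge-fiber X w false y) (edge-sym (a w) y))
  σ-edge X y@(mv _ _ _) (b w) =
    trans (edge-sym (σ X y) (σ X (b w))) (trans (σ-edge-fiber X w true y) (edge-sym (b w) y))
  σ-edge (mkKer _ _) (mv _ _ _) (mv _ _ _) = refl

  kerToAut : Ker adj → Aut adj
  kerToAut X = record
    { to = σ X ; from = σ X ; from-to = σ-involutive X ; to-from = σ-involutive X
    ; colour-pres = σ-colour X ; edge-pres = σ-edge X }

  -- Every colour-preserving automorphism φ is σ_x, where x_w records whether φ swaps F(w).
  module FromAut (φ : Aut adj) where
    open Aut φ

    flips : Fin m → Bool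
    flips w = isB (to (a w))

    -- φ preserves colours, so it maps F(w) to itself.
    φ-a : ∀ w → to (a w) ≡ fiber w (flips w)
    φ-a w = fiber-view (to (a w)) (colour-pres (a w))

    to-injective : ∀ {x y} → to x ≡ to y → x ≡ y
    to-injective {x} {y} e = trans (sym (from-to x)) (trans (cong from e) (from-to y))

    -- φ maps b(w) to the other vertex of F(w), as φ is injective.
    φ-b : ∀ w → to (b w) ≡ fiber w (not (flips w))
    φ-b w = trans φb≡ (cong (fiber w) (¬-not other-index))
      where
      φb≡ = fiber-view (to (b w)) (colour-pres (b w))
      other-index : isB (to (b w)) ≢ flips w
      other-index same with to-injective (trans (φ-a w) (trans (cong (fiber w) (sym same)) (sym φb≡)))
      ... | ()

    -- φ maps m_A(v) to m_B(v) with B = A + x∩N(v), by its adjacencies to the a(w).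
    φ-mv : ∀ v A p → Σ (Vec Bool m) λ B → Σ (T (okM adj v B)) λ q →
      to (mv v A p) ≡ mv v B q × (∀ w → lookup B w ≡ lookup A w xor (flips w ∧ adj v w))
    φ-mv v A p with middle-view (to (mv v A p)) (colour-pres (mv v A p))
    ... | B , q , φm≡ = B , q , φm≡ , λ w → label-determined (adj v w) (flips w) (lookup A w) (lookup B w)
      (proj₁ (Equivalence.to (okM⇔ adj v A) p) w) (proj₁ (Equivalence.to (okM⇔ adj v B) q) w) (begin
        adj v w ∧ (flips w xor lookup B w)  ≡⟨ edge-fiber adj w (flips w) v B q ⟨
        edge (fiber w (flips w)) (mv v B q) ≡⟨ cong₂ edge (φ-a w) φm≡ ⟨
        edge (to (a w)) (to (mv v A p))     ≡⟨ edge-pres (a w) (mv v A p) ⟩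
        edge (a w) (mv {adj = adj} v A p)   ≡⟨ edge-fiber adj w false v A p ⟩
        adj v w ∧ lookup A w                ∎)
      where open ≡-Reasoning

    -- x is in the kernel: the image of m_∅(v) is m_{x∩N(v)}(v), so x ∩ N(v) is even.
    flips-in-kernel : T (inKer adj (tabulate flips))
    flips-in-kernel = inKer-intro adj (tabulate flips) row-orthogonal
      where
      ∅-valid : ∀ v → T (okM adj v ⊥)
      ∅-valid v = Equivalence.from (okM⇔ adj v ⊥)
        (∅⊆N , xorSum-zero {m} (λ w → lookup-replicate w false))
        where
        ∅⊆N : InNbhd adj v ⊥
        ∅⊆N w ∅w≡1 with trans (sym ∅w≡1) (lookup-replicate w false)
        ... | ()
      row-orthogonal : ∀ v → dot adj v (tabulate flips) ≡ false
      row-orthogonal v with φ-mv v ⊥ (∅-valid v)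
      ... | B , q , _ , B≡ = trans (xorSum-cong same) (proj₂ (Equivalence.to (okM⇔ adj v B) q))
        where
        same : ∀ w → adj v w ∧ lookup (tabulate flips) w ≡ lookup B w
        same w = begin
          adj v w ∧ lookup (tabulate flips) w    ≡⟨ cong (adj v w ∧_) (lookup∘tabulate flips w) ⟩
          adj v w ∧ flips w                      ≡⟨ ∧-comm (adj v w) (flips w) ⟩
          false xor (flips w ∧ adj v w)          ≡⟨ cong (_xor (flips w ∧ adj v w)) (lookup-replicate w false) ⟨
          lookup ⊥ w xor (flips w ∧ adj v w)     ≡⟨ B≡ w ⟨
          lookup B w                             ∎
          where open ≡-Reasoning

    autToKer : Ker adj
    autToKer = mkKer (tabulate flips) flips-in-kernel

    σ-autToKer : ∀ y → σ autToKer y ≡ to y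
    σ-autToKer (a w) = trans (cong (fiber w) (lookup∘tabulate flips w)) (sym (φ-a w))
    σ-autToKer (b w) = trans (cong (λ s → fiber w (not s)) (lookup∘tabulate flips w)) (sym (φ-b w))
    σ-autToKer (mv v A p) with φ-mv v A p
    ... | B , q , φm≡ , B≡ = trans (mv-≡ v (trans (tabulate-cong same) (tabulate∘lookup B))) (sym φm≡)
      where
      same : ∀ w → lookup A w xor (lookup (tabulate flips) w ∧ adj v w) ≡ lookup B w
      same w = trans (cong (λ s → lookup A w xor (s ∧ adj v w)) (lookup∘tabulate flips w)) (sym (B≡ w))

  open FromAut using (autToKer; σ-autToKer)

  autToKer-cong : ∀ φ ψ → (∀ y → Aut.to φ y ≡ Aut.to ψ y) → autToKer φ ≡ autToKer ψ
  autToKer-cong φ ψ φ≈ψ = Ker-≡ (tabulate-cong (λ w → cong isB (φ≈ψ (a w))))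

  autToKer-σ : ∀ X → autToKer (kerToAut X) ≡ X
  autToKer-σ (mkKer x _) = Ker-≡ (trans (tabulate-cong (λ w → isB-fiber w (lookup x w))) (tabulate∘lookup x))

  aut↔ker : Inverse (AutSetoid adj) (setoid (Ker adj))
  aut↔ker = record
    { to        = autToKer
    ; from      = kerToAut
    ; to-cong   = λ {φ} {ψ} → autToKer-cong φ ψ
    ; from-cong = λ { refl y → refl }
    ; inverse   = (λ {X} {φ} φ≈σ → trans (autToKer-cong φ (kerToAut X) φ≈σ) (autToKer-σ X))
                , (λ { {φ} refl y → σ-autToKer φ y })
    }

lemma4 : ∀ {n m} (adj : BiGraph n m) (r : ℕ) → IsRank adj r →
           Inverse (AutSetoid adj) (setoid (Fin (2 ^ (m ∸ r))))
lemma4 adj r rank = Composition.inverse (aut↔ker adj) (kernel-size adj r rank)
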